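{- Let $f:\mathcal{PC}_6\to\mathcal{PC}_4$ be a graph homomorphism. If a vertex $x$ of $\mathcal{PC}_4$ satisfies $|f^{ -1}(x)|\ge5$, then there is a vertex $y$ of $\mathcal{PC}_4$ adjacent to $x$ with $|f^{ -1}(y)|\ge 5$; moreover, the common neighbor in $\mathcal{PC}_6$ of the vertices of $f^{ -1}(y)$ is adjacent to the common neighbor in $\mathcal{PC}_6$ of the vertices of $f^{ -1}(x)$.
   Context: The projective cube of dimension $d$, $\mathcal{PC}_d$, is the Cayley graph on $\mathbb{Z}_2^d$ with $u\sim v$ iff $u-v\in\{e_1,\dots,e_d,J\}$, where $e_1,\dots,e_d$ is the canonical basis and $J$ the all-ones vector. A homomorphism is a map of vertex sets sending edges to edges. For a homomorphism $f:\mathcal{PC}_6\to\mathcal{PC}_4$ and a vertex $x$ with $|f^{ -1}(x)|\ge5$, all vertices of $f^{ -1}(x)$ have a common neighbor in $\mathcal{PC}_6$ (a vertex $a$ with $f^{ -1}(x)\subseteq N(a)$), referred to as "the common neighbor" of $f^{ -1}(x)$. -}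

module Defs where

open import Data.Bool using (Bool; true; false; _xor_)
open import Data.Nat using (ℕ; zero; suc)
open import Data.Fin using (Fin)
open import Data.Vec using (Vec; []; _∷_; zipWith; replicate; updateAt)
open import Data.Vec.Properties using (≡-dec)
open import Data.List using (List; []; _∷_; map; _++_; filter; length)
open import Data.Product using (∃)
open import Data.Sum using (_⊎_)
open import Relation.Binary.PropositionalEquality using (_≡_)
import Data.Bool.Properties as BoolP
open import Relation.Nullary using (Dec)

-- Vertices of PC_d : elements of Z_2^d as Boolean vectors (addition = xor).
Vertex : ℕ → Set
Vertex d = Vec Bool d

_⊕_ : {d : ℕ} → Vertex d → Vertex d → Vertex d
u ⊕ v = zipWith _xor_ u v

e : {d : ℕ} → Fin d → Vertex d
e i = updateAt (replicate _ false) i (λ _ → true)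

J : {d : ℕ} → Vertex d
J = replicate _ true

Adj : {d : ℕ} → Vertex d → Vertex d → Set
Adj u v = (∃ λ i → u ⊕ v ≡ e i) ⊎ (u ⊕ v ≡ J)

IsHom : {m n : ℕ} → (Vertex m → Vertex n) → Set
IsHom {m} f = (u v : Vertex m) → Adj u v → Adj (f u) (f v)

allVertices : (d : ℕ) → List (Vertex d)
allVertices zero = [] ∷ []
allVertices (suc d) = map (false ∷_) (allVertices d) ++ map (true ∷_) (allVertices d)

_≟V_ : {d : ℕ} → (u v : Vertex d) → Dec (u ≡ v)
_≟V_ = ≡-dec BoolP._≟_

fibreSize : {m n : ℕ} → (Vertex m → Vertex n) → Vertex n → ℕ
fibreSize {m} f x = length (filter (λ u → f u ≟V x) (allVertices m))

IsCommonNbrOfFibre : {m n : ℕ} → (Vertex m → Vertex n) → Vertex n → Vertex m → Set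
IsCommonNbrOfFibre {m} f x a = (u : Vertex m) → f u ≡ x → Adj a u

module Submission where

-- PC₄ has no closed walk of length 3 and two distinct vertices of it have at most two common
-- neighbours; PC₆ has diameter 3. Hence two vertices of one fibre of f differ by exactly two
-- generators, never by four distinct ones (module Fibres). Five vertices of a fibre thus
-- differ from the first one by pairwise overlapping pairs of generators, which share a
-- generator: the fibre contains a star, five neighbours centre ⊕ gen s of one centre
-- (fibreStar). Colouring a pair of leaves {s, s′} by f (centre ⊕ gen s ⊕ gen s′) gives an edge
-- colouring of K₅ in which disjoint edges differ and no triangle is rainbow; such a colouring
-- has a monochromatic vertex (monochromaticVertex), and pivoting there, together with a
-- generator outside the star, gives a star in a neighbouring fibre whose centre is adjacent
-- (nextStar). A star yields five fibre vertices and makes its centre the only common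
-- neighbour of its fibre, which proves the theorem.

open import Defs

open import Algebra.Bundles using (CommutativeSemigroup)
import Algebra.Properties.CommutativeSemigroup
open import Data.Bool using (Bool; true; false)
open import Data.Bool.Properties using (xor-comm; xor-assoc; xor-same; xor-identityˡ; xor-identityʳ)
open import Data.Empty using (⊥; ⊥-elim)
open import Data.Fin using (Fin; zero; suc; inject≤; punchIn) renaming (_<_ to _<ᶠ_)
open import Data.Fin.Permutation using (Permutation′; _⟨$⟩ʳ_; _⟨$⟩ˡ_; inverseˡ; inverseʳ; transpose)
open import Data.Fin.Properties
  using (all?; any?; 0≢1+n; suc-injective; inject≤-injective; injective⇒≤; <-cmp; <⇒≢;
         punchIn-injective; punchInᵢ≢i)
  renaming (_≟_ to _≟ᶠ_; _<?_ to _<ᶠ?_)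
open import Data.List using (List; []; _∷_; map; filter; lookup)
open import Data.List.Membership.Propositional using (_∈_)
open import Data.List.Membership.Propositional.Properties
  using (∈-map⁺; ∈-map⁻; ∈-++⁺ˡ; ∈-++⁺ʳ; ∈-filter⁺; ∈-lookup)
open import Data.List.Relation.Unary.All using ([]; tabulate)
  renaming (lookup to All-lookup; all? to All-all?)
open import Data.List.Relation.Unary.All.Properties using (all-filter)
open import Data.List.Relation.Unary.AllPairs using ([]; _∷_)
open import Data.List.Relation.Unary.Any using (here; index)
open import Data.List.Relation.Unary.Any.Properties using (lookup-index)
open import Data.List.Relation.Unary.Unique.Propositional using (Unique)
import Data.List.Relation.Unary.Unique.Propositional.Properties as Unique
open import Data.Nat using (ℕ; zero; suc; _≤_; _<_; z<s)
open import Data.Nat.Properties using (<⇒≱; m<m+n)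
open import Data.Product using (Σ; _×_; _,_; proj₁; proj₂)
open import Data.Sum using (_⊎_; inj₁; inj₂)
open import Data.Vec using ([]; _∷_; replicate)
open import Data.Vec.Properties using (zipWith-comm; zipWith-assoc; zipWith-identityˡ; zipWith-identityʳ)
open import Function.Definitions using (Injective)
open import Relation.Binary.Definitions using (DecidableEquality; tri<; tri≈; tri>)
open import Relation.Binary.PropositionalEquality
  using (_≡_; _≢_; refl; sym; trans; cong; cong₂; subst; subst₂; module ≡-Reasoning)
open import Relation.Binary.PropositionalEquality.Algebra using (isMagma)
open import Relation.Nullary using (¬_; Dec; yes; no)
open import Relation.Nullary.Decidable using (_×-dec_; _⊎-dec_; _→-dec_; ¬?; from-yes; True; toWitness)

0ᵛ : {n : ℕ} → Vertex n
0ᵛ = replicate _ false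

⊕-comm : {n : ℕ} (u v : Vertex n) → u ⊕ v ≡ v ⊕ u
⊕-comm = zipWith-comm xor-comm

⊕-assoc : {n : ℕ} (u v w : Vertex n) → (u ⊕ v) ⊕ w ≡ u ⊕ (v ⊕ w)
⊕-assoc = zipWith-assoc xor-assoc

⊕-identityˡ : {n : ℕ} (u : Vertex n) → 0ᵛ ⊕ u ≡ u
⊕-identityˡ = zipWith-identityˡ xor-identityˡ

⊕-identityʳ : {n : ℕ} (u : Vertex n) → u ⊕ 0ᵛ ≡ u
⊕-identityʳ = zipWith-identityʳ xor-identityʳ

⊕-self : {n : ℕ} (u : Vertex n) → u ⊕ u ≡ 0ᵛ
⊕-self [] = refl
⊕-self (b ∷ u) = cong₂ _∷_ (xor-same b) (⊕-self u)

⊕-commutativeSemigroup : ℕ → CommutativeSemigroup _ _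
⊕-commutativeSemigroup n = record
  { _∙_ = _⊕_ {n}
  ; isCommutativeSemigroup = record
    { isSemigroup = record { isMagma = isMagma _⊕_ ; assoc = ⊕-assoc }
    ; comm = ⊕-comm } }

module ⊕-Rearrange {n : ℕ} = Algebra.Properties.CommutativeSemigroup (⊕-commutativeSemigroup n)
open ⊕-Rearrange using (interchange; xy∙z≈xz∙y; xy∙z≈zx∙y)

⊕-cancelˡ : {n : ℕ} (u v : Vertex n) → u ⊕ (u ⊕ v) ≡ v
⊕-cancelˡ u v = begin
  u ⊕ (u ⊕ v)  ≡⟨ sym (⊕-assoc u u v) ⟩
  (u ⊕ u) ⊕ v  ≡⟨ cong (_⊕ v) (⊕-self u) ⟩
  0ᵛ ⊕ v       ≡⟨ ⊕-identityˡ v ⟩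
  v            ∎
  where open ≡-Reasoning

⊕-solve : {n : ℕ} {u v w : Vertex n} → u ⊕ v ≡ w → v ≡ u ⊕ w
⊕-solve {u = u} {v} eq = trans (sym (⊕-cancelˡ u v)) (cong (u ⊕_) eq)

⊕-cancelʳ : {n : ℕ} (u v : Vertex n) → (u ⊕ v) ⊕ v ≡ u
⊕-cancelʳ u v = trans (⊕-assoc u v v) (trans (cong (u ⊕_) (⊕-self v)) (⊕-identityʳ u))

⊕-injectiveʳ : {n : ℕ} (a : Vertex n) {u v : Vertex n} → a ⊕ u ≡ a ⊕ v → u ≡ v
⊕-injectiveʳ a eq = trans (⊕-solve eq) (⊕-cancelˡ a _)

⊕-zero⇒≡ : {n : ℕ} {u v : Vertex n} → u ⊕ v ≡ 0ᵛ → u ≡ v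
⊕-zero⇒≡ {u = u} eq = sym (trans (⊕-solve eq) (⊕-identityʳ u))

⊕-translate : {n : ℕ} (a x y : Vertex n) → (a ⊕ x) ⊕ (a ⊕ y) ≡ x ⊕ y
⊕-translate a x y = begin
  (a ⊕ x) ⊕ (a ⊕ y)  ≡⟨ interchange a x a y ⟩
  (a ⊕ a) ⊕ (x ⊕ y)  ≡⟨ cong (_⊕ (x ⊕ y)) (⊕-self a) ⟩
  0ᵛ ⊕ (x ⊕ y)       ≡⟨ ⊕-identityˡ (x ⊕ y) ⟩
  x ⊕ y              ∎
  where open ≡-Reasoning

⊕-chain : {n : ℕ} (x p y : Vertex n) → (x ⊕ p) ⊕ (p ⊕ y) ≡ x ⊕ y
⊕-chain x p y = begin
  (x ⊕ p) ⊕ (p ⊕ y)  ≡⟨ ⊕-assoc x p (p ⊕ y) ⟩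
  x ⊕ (p ⊕ (p ⊕ y))  ≡⟨ cong (x ⊕_) (⊕-cancelˡ p y) ⟩
  x ⊕ y              ∎
  where open ≡-Reasoning

gen : {d : ℕ} → Fin (suc d) → Vertex d
gen zero = J
gen (suc i) = e i

adj⇒gen : {d : ℕ} {u v : Vertex d} → Adj u v → Σ (Fin (suc d)) λ i → u ⊕ v ≡ gen i
adj⇒gen (inj₁ (i , eq)) = suc i , eq
adj⇒gen (inj₂ eq) = zero , eq

gen⇒adj : {d : ℕ} {u v : Vertex d} (i : Fin (suc d)) → u ⊕ v ≡ gen i → Adj u v
gen⇒adj zero eq = inj₂ eq
gen⇒adj (suc i) eq = inj₁ (i , eq)

adj-sym : {d : ℕ} {u v : Vertex d} → Adj u v → Adj v u
adj-sym {u = u} {v} uv with adj⇒gen uv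
... | i , eq = gen⇒adj i (trans (⊕-comm v u) eq)

adj-step : {d : ℕ} (u : Vertex d) (i : Fin (suc d)) → Adj u (u ⊕ gen i)
adj-step u i = gen⇒adj i (⊕-cancelˡ u (gen i))

adj-extend : {d : ℕ} (a X : Vertex d) (i : Fin (suc d)) → Adj (a ⊕ X) (a ⊕ (X ⊕ gen i))
adj-extend a X i = subst (Adj (a ⊕ X)) (⊕-assoc a X (gen i)) (adj-step (a ⊕ X) i)

Distinct₃ : {A : Set} → A → A → A → Set
Distinct₃ a b c = a ≢ b × a ≢ c × b ≢ c

Distinct₄ : {A : Set} → A → A → A → A → Set
Distinct₄ a b c d = Distinct₃ a b c × a ≢ d × b ≢ d × c ≢ d

distinct₃? : {k : ℕ} (a b c : Fin k) → Dec (Distinct₃ a b c)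
distinct₃? a b c = ¬? (a ≟ᶠ b) ×-dec ¬? (a ≟ᶠ c) ×-dec ¬? (b ≟ᶠ c)

distinct₄? : {k : ℕ} (a b c d : Fin k) → Dec (Distinct₄ a b c d)
distinct₄? a b c d = distinct₃? a b c ×-dec ¬? (a ≟ᶠ d) ×-dec ¬? (b ≟ᶠ d) ×-dec ¬? (c ≟ᶠ d)

distinct!₃ : {k : ℕ} {a b c : Fin k} {_ : True (distinct₃? a b c)} → Distinct₃ a b c
distinct!₃ {a = a} {b} {c} {ok} = toWitness {a? = distinct₃? a b c} ok

distinct!₄ : {k : ℕ} {a b c d : Fin k} {_ : True (distinct₄? a b c d)} → Distinct₄ a b c d
distinct!₄ {a = a} {b} {c} {d} {ok} = toWitness {a? = distinct₄? a b c d} ok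

PairSumsDetermined : ℕ → Set
PairSumsDetermined d = (α β δ ε : Fin (suc d)) → α ≢ β →
  gen α ⊕ gen δ ≡ gen β ⊕ gen ε → (δ ≡ β) ⊎ (δ ≡ α)

squareCompletion : {d : ℕ} → PairSumsDetermined d → {x y p q : Vertex d} → x ≢ y → p ≢ q →
  Adj x p → Adj p y → Adj x q → Adj q y → y ≡ p ⊕ (x ⊕ q)
squareCompletion det {x} {y} {p} {q} x≢y p≢q xp py xq qy
  with adj⇒gen xp | adj⇒gen py | adj⇒gen xq | adj⇒gen qy
... | α , xp≡α | δ , py≡δ | β , xq≡β | ε , qy≡ε with det α β δ ε α≢β sums
  where
  α≢β : α ≢ β
  α≢β refl = p≢q (trans (⊕-solve xp≡α) (sym (⊕-solve xq≡β)))
  sums : gen α ⊕ gen δ ≡ gen β ⊕ gen ε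
  sums = begin
    gen α ⊕ gen δ      ≡⟨ cong₂ _⊕_ (sym xp≡α) (sym py≡δ) ⟩
    (x ⊕ p) ⊕ (p ⊕ y)  ≡⟨ ⊕-chain x p y ⟩
    x ⊕ y              ≡⟨ sym (⊕-chain x q y) ⟩
    (x ⊕ q) ⊕ (q ⊕ y)  ≡⟨ cong₂ _⊕_ xq≡β qy≡ε ⟩
    gen β ⊕ gen ε      ∎
    where open ≡-Reasoning
... | inj₁ refl = trans (⊕-solve py≡δ) (cong (p ⊕_) (sym xq≡β))
... | inj₂ refl = ⊥-elim (x≢y (⊕-zero⇒≡ (begin
    x ⊕ y              ≡⟨ sym (⊕-chain x p y) ⟩
    (x ⊕ p) ⊕ (p ⊕ y)  ≡⟨ cong₂ _⊕_ xp≡α py≡δ ⟩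
    gen α ⊕ gen α      ≡⟨ ⊕-self (gen α) ⟩
    0ᵛ                 ∎)))
  where open ≡-Reasoning

atMostTwoCommonNeighbours : {d : ℕ} → PairSumsDetermined d → {x y p q r : Vertex d} → x ≢ y →
  Adj x p → Adj p y → Adj x q → Adj q y → Adj x r → Adj r y → p ≢ q → p ≢ r → q ≡ r
atMostTwoCommonNeighbours det {x} {y} {p} {q} {r} x≢y xp py xq qy xr ry p≢q p≢r =
  ⊕-injectiveʳ x (⊕-injectiveʳ p (trans (sym (squareCompletion det x≢y p≢q xp py xq qy))
                                          (squareCompletion det x≢y p≢r xp py xr ry)))

-- No three generators of PC_d sum to zero (repetitions allowed): PC_d has neither loops
-- nor triangles.
NoThreeGeneratorRelation : ℕ → Set
NoThreeGeneratorRelation d = (α β γ : Fin (suc d)) → gen α ⊕ (gen β ⊕ gen γ) ≢ 0ᵛ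

noClosedWalk₃ : {d : ℕ} → NoThreeGeneratorRelation d → {y₀ y₁ y₂ : Vertex d} →
  Adj y₀ y₁ → Adj y₁ y₂ → Adj y₂ y₀ → ⊥
noClosedWalk₃ noRel {y₀} {y₁} {y₂} a b c
  with adj⇒gen a | adj⇒gen b | adj⇒gen c
... | α , eα | β , eβ | γ , eγ = noRel α β γ (begin
  gen α ⊕ (gen β ⊕ gen γ)              ≡⟨ cong₂ _⊕_ (sym eα) (cong₂ _⊕_ (sym eβ) (sym eγ)) ⟩
  (y₀ ⊕ y₁) ⊕ ((y₁ ⊕ y₂) ⊕ (y₂ ⊕ y₀))  ≡⟨ cong ((y₀ ⊕ y₁) ⊕_) (⊕-chain y₁ y₂ y₀) ⟩
  (y₀ ⊕ y₁) ⊕ (y₁ ⊕ y₀)                ≡⟨ ⊕-chain y₀ y₁ y₀ ⟩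
  y₀ ⊕ y₀                              ≡⟨ ⊕-self y₀ ⟩
  0ᵛ                                   ∎)
  where open ≡-Reasoning

-- Every vertex of PC_d is a sum of two or of three generators (repetitions allowed),
-- i.e. PC_d has diameter at most 3.
SpannedByTwoOrThree : ℕ → Set
SpannedByTwoOrThree d = (v : Vertex d) →
  (Σ (Fin (suc d)) λ p → Σ (Fin (suc d)) λ q → v ≡ gen p ⊕ gen q) ⊎
  (Σ (Fin (suc d)) λ p → Σ (Fin (suc d)) λ q → Σ (Fin (suc d)) λ r → v ≡ gen p ⊕ (gen q ⊕ gen r))

FourSumsAreNotPairSums : ℕ → Set
FourSumsAreNotPairSums d = (i j k l : Fin (suc d)) → Distinct₄ i j k l →
  (p q : Fin (suc d)) → (gen i ⊕ gen j) ⊕ (gen k ⊕ gen l) ≢ gen p ⊕ gen q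

Overlap : {n : ℕ} (i j k l : Fin n) → Set
Overlap i j k l = (i ≡ k ⊎ i ≡ l ⊎ j ≡ k ⊎ j ≡ l) × ¬ (i ≡ k × j ≡ l)

overlap? : {n : ℕ} (i j k l : Fin n) → Dec (Overlap i j k l)
overlap? i j k l = ((i ≟ᶠ k) ⊎-dec (i ≟ᶠ l) ⊎-dec (j ≟ᶠ k) ⊎-dec (j ≟ᶠ l)) ×-dec ¬? ((i ≟ᶠ k) ×-dec (j ≟ᶠ l))

_∈₂_,_ : {n : ℕ} → Fin n → Fin n → Fin n → Set
c ∈₂ i , j = c ≡ i ⊎ c ≡ j

-- Four pairwise overlapping 2-subsets share a common element (three of them could form a
-- triangle, but no fourth 2-subset overlaps all three sides of a triangle).
FourOverlappingPairsShareAPoint : ℕ → Set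
FourOverlappingPairsShareAPoint n =
  (i₁ j₁ : Fin n) → i₁ <ᶠ j₁ → (i₂ j₂ : Fin n) → i₂ <ᶠ j₂ → Overlap i₁ j₁ i₂ j₂ →
  (i₃ j₃ : Fin n) → i₃ <ᶠ j₃ → Overlap i₁ j₁ i₃ j₃ → Overlap i₂ j₂ i₃ j₃ →
  (i₄ j₄ : Fin n) → i₄ <ᶠ j₄ → Overlap i₁ j₁ i₄ j₄ → Overlap i₂ j₂ i₄ j₄ → Overlap i₃ j₃ i₄ j₄ →
  Σ (Fin n) λ c → c ∈₂ i₁ , j₁ × c ∈₂ i₂ , j₂ × c ∈₂ i₃ , j₃ × c ∈₂ i₄ , j₄

-- Fibres of a homomorphism f : PC_m → PC_n when PC_n has no closed walks of length 3 and
-- PC_m has diameter at most 3: two vertices with the same image differ by a sum of two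
-- generators, and never by a sum of four distinct generators.
module Fibres {m n : ℕ} (spanned : SpannedByTwoOrThree m) (noRel : NoThreeGeneratorRelation n)
              (fourSums : FourSumsAreNotPairSums m) (f : Vertex m → Vertex n) (hom : IsHom f) where

  -- A walk of length 3 along generators is not collapsed to a closed walk.
  threeStepsApart : (u : Vertex m) (p q r : Fin (suc m)) → f u ≢ f (u ⊕ (gen p ⊕ (gen q ⊕ gen r)))
  threeStepsApart u p q r fu≡fw = noClosedWalk₃ noRel
    (hom _ _ (adj-step u p))
    (hom _ _ (adj-step (u ⊕ gen p) q))
    (subst (Adj (f ((u ⊕ gen p) ⊕ gen q))) (sym fu≡fw)
      (subst (λ w → Adj (f ((u ⊕ gen p) ⊕ gen q)) (f w)) walkEnd
        (hom _ _ (adj-step ((u ⊕ gen p) ⊕ gen q) r))))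
    where
    walkEnd : ((u ⊕ gen p) ⊕ gen q) ⊕ gen r ≡ u ⊕ (gen p ⊕ (gen q ⊕ gen r))
    walkEnd = trans (⊕-assoc (u ⊕ gen p) (gen q) (gen r)) (⊕-assoc u (gen p) (gen q ⊕ gen r))

  fibreDifference : {u v : Vertex m} → f u ≡ f v →
    Σ (Fin (suc m)) λ p → Σ (Fin (suc m)) λ q → u ⊕ v ≡ gen p ⊕ gen q
  fibreDifference {u} {v} fu≡fv with spanned (u ⊕ v)
  ... | inj₁ pair = pair
  ... | inj₂ (p , q , r , eq) =
    ⊥-elim (threeStepsApart u p q r (trans fu≡fv (cong f (trans (⊕-solve refl) (cong (u ⊕_) eq)))))

  separated : {i j k l : Fin (suc m)} → Distinct₄ i j k l → {u v : Vertex m} →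
    u ⊕ v ≡ (gen i ⊕ gen j) ⊕ (gen k ⊕ gen l) → f u ≢ f v
  separated {i} {j} {k} {l} ijkl eq fu≡fv with fibreDifference fu≡fv
  ... | p , q , eq′ = fourSums i j k l ijkl p q (trans (sym eq) eq′)

  record PairStep (u v : Vertex m) : Set where
    field
      lo hi : Fin (suc m)
      lo<hi : lo <ᶠ hi
      reach : v ≡ u ⊕ (gen lo ⊕ gen hi)

  pairStep : {u v : Vertex m} → f u ≡ f v → u ≢ v → PairStep u v
  pairStep {u} {v} fu≡fv u≢v with fibreDifference fu≡fv
  ... | p , q , eq with <-cmp p q
  ...   | tri< p<q _ _ = record { lo = p ; hi = q ; lo<hi = p<q ; reach = ⊕-solve eq }
  ...   | tri≈ _ refl _ = ⊥-elim (u≢v (⊕-zero⇒≡ (trans eq (⊕-self (gen p)))))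
  ...   | tri> _ _ q<p = record { lo = q ; hi = p ; lo<hi = q<p
                                ; reach = trans (⊕-solve eq) (cong (u ⊕_) (⊕-comm (gen p) (gen q))) }

  -- Two further fibre vertices reached from the same u use overlapping pairs of generators:
  -- equal pairs would give the same vertex, disjoint ones a difference of four generators.
  stepsOverlap : {u v w : Vertex m} → f v ≡ f w → v ≢ w → (P : PairStep u v) (Q : PairStep u w) →
    Overlap (PairStep.lo P) (PairStep.hi P) (PairStep.lo Q) (PairStep.hi Q)
  stepsOverlap {u} {v} {w} fv≡fw v≢w P Q = meet , different
    where
    open PairStep P renaming (lo to i; hi to j; lo<hi to i<j; reach to reachᵥ)
    open PairStep Q renaming (lo to k; hi to l; lo<hi to k<l; reach to reachʷ)
    different : ¬ (i ≡ k × j ≡ l)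
    different (refl , refl) = v≢w (trans reachᵥ (sym reachʷ))
    meet : i ≡ k ⊎ i ≡ l ⊎ j ≡ k ⊎ j ≡ l
    meet with (i ≟ᶠ k) ⊎-dec (i ≟ᶠ l) ⊎-dec (j ≟ᶠ k) ⊎-dec (j ≟ᶠ l)
    ... | yes shared = shared
    ... | no disjoint = ⊥-elim (separated ijkl difference fv≡fw)
      where
      ijkl : Distinct₄ i j k l
      ijkl = ( <⇒≢ i<j , (λ e → disjoint (inj₁ e)) , (λ e → disjoint (inj₂ (inj₂ (inj₁ e)))) )
           , (λ e → disjoint (inj₂ (inj₁ e))) , (λ e → disjoint (inj₂ (inj₂ (inj₂ e)))) , <⇒≢ k<l
      difference : v ⊕ w ≡ (gen i ⊕ gen j) ⊕ (gen k ⊕ gen l)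
      difference = trans (cong₂ _⊕_ reachᵥ reachʷ) (⊕-translate u _ _)

allVertices-complete : {d : ℕ} (v : Vertex d) → v ∈ allVertices d
allVertices-complete [] = here refl
allVertices-complete {suc d} (false ∷ v) = ∈-++⁺ˡ (∈-map⁺ (false ∷_) (allVertices-complete v))
allVertices-complete {suc d} (true ∷ v) =
  ∈-++⁺ʳ (map (false ∷_) (allVertices d)) (∈-map⁺ (true ∷_) (allVertices-complete v))

allVertices-unique : (d : ℕ) → Unique (allVertices d)
allVertices-unique zero = [] ∷ []
allVertices-unique (suc d) =
  Unique.++⁺ (Unique.map⁺ ∷-injectiveʳ (allVertices-unique d))
             (Unique.map⁺ ∷-injectiveʳ (allVertices-unique d)) firstBitDiffers
  where
  ∷-injectiveʳ : {b : Bool} {u v : Vertex d} → _≡_ {A = Vertex (suc d)} (b ∷ u) (b ∷ v) → u ≡ v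
  ∷-injectiveʳ refl = refl
  firstBitDiffers : {v : Vertex (suc d)} →
    ¬ (v ∈ map (false ∷_) (allVertices d) × v ∈ map (true ∷_) (allVertices d))
  firstBitDiffers (p , q) with ∈-map⁻ (false ∷_) p | ∈-map⁻ (true ∷_) q
  ... | _ , _ , refl | _ , _ , ()

∀-vertex? : {d : ℕ} {P : Vertex d → Set} → ((v : Vertex d) → Dec (P v)) → Dec ((v : Vertex d) → P v)
∀-vertex? {d} P? with All-all? P? (allVertices d)
... | yes all = yes λ v → All-lookup all (allVertices-complete v)
... | no ¬all = no λ all → ¬all (tabulate λ {v} _ → all v)

lookup-injective : {A : Set} {xs : List A} → Unique xs → Injective _≡_ _≡_ (lookup xs)
lookup-injective (_ ∷ _) {zero} {zero} _ = refl
lookup-injective (x∉xs ∷ _) {zero} {suc j} eq = ⊥-elim (All-lookup x∉xs (∈-lookup j) eq)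
lookup-injective (x∉xs ∷ _) {suc i} {zero} eq = ⊥-elim (All-lookup x∉xs (∈-lookup i) (sym eq))
lookup-injective (_ ∷ unique) {suc i} {suc j} eq = cong suc (lookup-injective unique eq)

FibreFamily : {m n : ℕ} → ℕ → (Vertex m → Vertex n) → Vertex n → Set
FibreFamily {m} k f x = Σ (Fin k → Vertex m) λ u → Injective _≡_ _≡_ u × ((i : Fin k) → f (u i) ≡ x)

module _ {m n : ℕ} (f : Vertex m → Vertex n) (x : Vertex n) where

  private
    inFibre? : (u : Vertex m) → Dec (f u ≡ x)
    inFibre? u = f u ≟V x
    fibre : List (Vertex m)
    fibre = filter inFibre? (allVertices m)

  fibreSize⇒family : {k : ℕ} → k ≤ fibreSize f x → FibreFamily k f x
  fibreSize⇒family {k} k≤ = u , u-injective , λ i → All-lookup (all-filter inFibre? (allVertices m)) (∈-lookup _)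
    where
    u : Fin k → Vertex m
    u i = lookup fibre (inject≤ i k≤)
    u-injective : Injective _≡_ _≡_ u
    u-injective {i} {j} eq = inject≤-injective k≤ k≤ i j
      (lookup-injective (Unique.filter⁺ inFibre? (allVertices-unique m)) eq)

  family⇒fibreSize : {k : ℕ} → FibreFamily k f x → k ≤ fibreSize f x
  family⇒fibreSize {k} (u , u-injective , u-in-fibre) = injective⇒≤ position-injective
    where
    listed : (i : Fin k) → u i ∈ fibre
    listed i = ∈-filter⁺ inFibre? (allVertices-complete (u i)) (u-in-fibre i)
    position : Fin k → Fin (fibreSize f x)
    position i = index (listed i)
    position-injective : Injective _≡_ _≡_ position
    position-injective {i} {j} eq = u-injective
      (trans (lookup-index (listed i)) (trans (cong (lookup fibre) eq) (sym (lookup-index (listed j)))))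

missedValue : {k n : ℕ} → k < n → (s : Fin k → Fin n) → Σ (Fin n) λ t → (i : Fin k) → s i ≢ t
missedValue {k} {n} k<n s with any? (λ t → all? λ i → ¬? (s i ≟ᶠ t))
... | yes missed = missed
... | no ¬missed = ⊥-elim (<⇒≱ k<n (injective⇒≤ preimage-injective))
  where
  preimage : (t : Fin n) → Σ (Fin k) λ i → s i ≡ t
  preimage t with any? (λ i → s i ≟ᶠ t)
  ... | yes hit = hit
  ... | no ¬hit = ⊥-elim (¬missed (t , λ i e → ¬hit (i , e)))
  preimage-injective : Injective _≡_ _≡_ (λ t → proj₁ (preimage t))
  preimage-injective {t} {t′} eq = trans (sym (proj₂ (preimage t))) (trans (cong s eq) (proj₂ (preimage t′)))

fourthElement : (m n p : Fin 5) → Σ (Fin 5) λ q → q ≢ m × q ≢ n × q ≢ p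
fourthElement m n p with missedValue (m<m+n 3 z<s) (λ { zero → m ; (suc zero) → n ; _ → p })
... | q , missed = q , (λ e → missed zero (sym e)) , (λ e → missed (suc zero) (sym e))
                     , (λ e → missed (suc (suc zero)) (sym e))

pattern F0 = zero
pattern F1 = suc zero
pattern F2 = suc (suc zero)
pattern F3 = suc (suc (suc zero))
pattern F4 = suc (suc (suc (suc zero)))

record GoodColouring (C : Set) : Set where
  field
    colour : Fin 5 → Fin 5 → C
    colour-sym : ∀ m n → colour m n ≡ colour n m
    disjointEdgesDiffer : ∀ m n p q → Distinct₄ m n p q → colour m n ≢ colour p q
    noRainbowTriangle : ∀ m n p → Distinct₃ m n p →
      colour m n ≡ colour m p ⊎ colour m n ≡ colour n p ⊎ colour m p ≡ colour n p

  sameAtFirst : ∀ m n p → Distinct₃ m n p →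
    colour m n ≢ colour n p → colour m p ≢ colour n p → colour m n ≡ colour m p
  sameAtFirst m n p mnp ¬₂ ¬₃ with noRainbowTriangle m n p mnp
  ... | inj₁ e = e
  ... | inj₂ (inj₁ e) = ⊥-elim (¬₂ e)
  ... | inj₂ (inj₂ e) = ⊥-elim (¬₃ e)

  sameAtSecond : ∀ m n p → Distinct₃ m n p →
    colour m n ≢ colour m p → colour m p ≢ colour n p → colour m n ≡ colour n p
  sameAtSecond m n p mnp ¬₁ ¬₃ with noRainbowTriangle m n p mnp
  ... | inj₁ e = ⊥-elim (¬₁ e)
  ... | inj₂ (inj₁ e) = e
  ... | inj₂ (inj₂ e) = ⊥-elim (¬₃ e)

open GoodColouring using ()
  renaming (colour to colourOf; colour-sym to colourOf-sym; noRainbowTriangle to noRainbowTriangleOf)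

MonochromaticVertex : {C : Set} → GoodColouring C → Set
MonochromaticVertex {C} K = Σ (Fin 5) λ k → Σ C λ c → ∀ l → l ≢ k → colourOf K k l ≡ c

relabel : {C : Set} → Permutation′ 5 → GoodColouring C → GoodColouring C
relabel π K = record
  { colour = λ m n → colour (π ⟨$⟩ʳ m) (π ⟨$⟩ʳ n)
  ; colour-sym = λ m n → colour-sym (π ⟨$⟩ʳ m) (π ⟨$⟩ʳ n)
  ; disjointEdgesDiffer = λ m n p q ((mn , mp , np) , mq , nq , pq) →
      disjointEdgesDiffer _ _ _ _ ((π≢ mn , π≢ mp , π≢ np) , π≢ mq , π≢ nq , π≢ pq)
  ; noRainbowTriangle = λ m n p (mn , mp , np) → noRainbowTriangle _ _ _ (π≢ mn , π≢ mp , π≢ np)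
  }
  where
  open GoodColouring K
  π≢ : ∀ {m n} → m ≢ n → π ⟨$⟩ʳ m ≢ π ⟨$⟩ʳ n
  π≢ {m} {n} m≢n eq = m≢n (trans (sym (inverseˡ π)) (trans (cong (π ⟨$⟩ˡ_) eq) (inverseˡ π)))

unrelabel : {C : Set} (π : Permutation′ 5) (K : GoodColouring C) →
  MonochromaticVertex (relabel π K) → MonochromaticVertex K
unrelabel π K (k , c , row) = π ⟨$⟩ʳ k , c , λ l l≢ →
  subst (λ z → colourOf K (π ⟨$⟩ʳ k) z ≡ c) (inverseʳ π)
    (row (π ⟨$⟩ˡ l) λ eq → l≢ (trans (sym (inverseʳ π)) (cong (π ⟨$⟩ʳ_) eq)))

module _ {C : Set} (_≟C_ : DecidableEquality C) where

  monochromatic-split : (K : GoodColouring C) → colourOf K F2 F3 ≡ colourOf K F2 F4 →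
    colourOf K F2 F0 ≢ colourOf K F2 F3 → MonochromaticVertex K
  monochromatic-split K 23≡24 20≢23 = decideRow (colour F0 F1 ≟C colour F0 F2)
    where
    open GoodColouring K
    02≡03 : colour F0 F2 ≡ colour F0 F3
    02≡03 = sameAtFirst F0 F2 F3 distinct!₃ (λ e → 20≢23 (trans (colour-sym F2 F0) e))
                                           (λ e → disjointEdgesDiffer F0 F3 F2 F4 distinct!₄ (trans e 23≡24))
    02≡04 : colour F0 F2 ≡ colour F0 F4
    02≡04 = sameAtFirst F0 F2 F4 distinct!₃ (λ e → 20≢23 (trans (colour-sym F2 F0) (trans e (sym 23≡24))))
                                           (λ e → disjointEdgesDiffer F0 F4 F2 F3 distinct!₄ (trans e (sym 23≡24)))
    decideRow : Dec (colour F0 F1 ≡ colour F0 F2) → MonochromaticVertex K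
    decideRow (yes 01≡02) = F0 , colour F0 F2 , λ
      { F0 0≢0 → ⊥-elim (0≢0 refl) ; F1 _ → 01≡02 ; F2 _ → refl ; F3 _ → sym 02≡03 ; F4 _ → sym 02≡04 }
    decideRow (no 01≢02) = F1 , colour F0 F1 , λ
      { F0 _ → colour-sym F1 F0 ; F1 1≢1 → ⊥-elim (1≢1 refl) ; F2 _ → sym 01≡12 ; F3 _ → sym 01≡13 ; F4 _ → sym 01≡14 }
      where
      01≡12 : colour F0 F1 ≡ colour F1 F2
      01≡12 = sameAtSecond F0 F1 F2 distinct!₃ 01≢02
        (λ e → disjointEdgesDiffer F1 F2 F0 F3 distinct!₄ (trans (sym e) 02≡03))
      01≡13 : colour F0 F1 ≡ colour F1 F3
      01≡13 = sameAtSecond F0 F1 F3 distinct!₃ (λ e → 01≢02 (trans e (sym 02≡03)))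
        (λ e → disjointEdgesDiffer F1 F3 F0 F4 distinct!₄ (trans (sym e) (trans (sym 02≡03) 02≡04)))
      01≡14 : colour F0 F1 ≡ colour F1 F4
      01≡14 = sameAtSecond F0 F1 F4 distinct!₃ (λ e → 01≢02 (trans e (sym 02≡04)))
        (λ e → disjointEdgesDiffer F1 F4 F0 F2 distinct!₄ (trans (sym e) (sym 02≡04)))

  monochromatic-repeat : (K : GoodColouring C) → colourOf K F2 F3 ≡ colourOf K F2 F4 →
    MonochromaticVertex K
  monochromatic-repeat K 23≡24 with colourOf K F2 F0 ≟C colourOf K F2 F3 | colourOf K F2 F1 ≟C colourOf K F2 F3
  ... | no 20≢23 | _ = monochromatic-split K 23≡24 20≢23
  ... | yes 20≡23 | yes 21≡23 = F2 , colourOf K F2 F3 , λ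
    { F0 _ → 20≡23 ; F1 _ → 21≡23 ; F2 2≢2 → ⊥-elim (2≢2 refl) ; F3 _ → refl ; F4 _ → sym 23≡24 }
  ... | yes _ | no 21≢23 =
    unrelabel (transpose F0 F1) K (monochromatic-split (relabel (transpose F0 F1) K) 23≡24 21≢23)

  monochromaticVertex : (K : GoodColouring C) → MonochromaticVertex K
  monochromaticVertex K with noRainbowTriangleOf K F2 F3 F4 distinct!₃
  ... | inj₁ 23≡24 = monochromatic-repeat K 23≡24
  ... | inj₂ (inj₁ 23≡34) = unrelabel (transpose F2 F3) K
    (monochromatic-repeat (relabel (transpose F2 F3) K) (trans (colourOf-sym K F3 F2) 23≡34))
  ... | inj₂ (inj₂ 24≡34) = unrelabel (transpose F2 F4) K
    (monochromatic-repeat (relabel (transpose F2 F4) K)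
      (trans (colourOf-sym K F4 F3) (trans (sym 24≡34) (colourOf-sym K F2 F4))))

-- The finitely many facts about PC_4 and PC_6 used below, each decided by exhaustive
-- evaluation. They are opaque so that their proof terms are never unfolded again.
opaque
  noThreeGeneratorRelation₄ : NoThreeGeneratorRelation 4
  noThreeGeneratorRelation₄ =
    from-yes (all? λ (α : Fin 5) → all? λ β → all? λ γ → ¬? ((gen α ⊕ (gen β ⊕ gen γ)) ≟V 0ᵛ))

  pairSumsDetermined₄ : PairSumsDetermined 4
  pairSumsDetermined₄ = from-yes (all? λ (α : Fin 5) → all? λ β → all? λ δ → all? λ ε →
    ¬? (α ≟ᶠ β) →-dec ((gen α ⊕ gen δ) ≟V (gen β ⊕ gen ε)) →-dec ((δ ≟ᶠ β) ⊎-dec (δ ≟ᶠ α)))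

  pairSumsDetermined₆ : PairSumsDetermined 6
  pairSumsDetermined₆ = from-yes (all? λ (α : Fin 7) → all? λ β → all? λ δ → all? λ ε →
    ¬? (α ≟ᶠ β) →-dec ((gen α ⊕ gen δ) ≟V (gen β ⊕ gen ε)) →-dec ((δ ≟ᶠ β) ⊎-dec (δ ≟ᶠ α)))

  gen-injective₆ : (i j : Fin 7) → gen i ≡ gen j → i ≡ j
  gen-injective₆ = from-yes (all? λ (i : Fin 7) → all? λ j → (gen i ≟V gen j) →-dec (i ≟ᶠ j))

  fourSumsAreNotPairSums₆ : FourSumsAreNotPairSums 6
  fourSumsAreNotPairSums₆ = from-yes (all? λ (i : Fin 7) → all? λ j → all? λ k → all? λ l →
    distinct₄? i j k l →-dec all? λ p → all? λ q →
    ¬? (((gen i ⊕ gen j) ⊕ (gen k ⊕ gen l)) ≟V (gen p ⊕ gen q)))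

  spannedByTwoOrThree₆ : SpannedByTwoOrThree 6
  spannedByTwoOrThree₆ = from-yes (∀-vertex? λ v →
    any? (λ (p : Fin 7) → any? λ q → v ≟V (gen p ⊕ gen q)) ⊎-dec
    any? (λ (p : Fin 7) → any? λ q → any? λ r → v ≟V (gen p ⊕ (gen q ⊕ gen r))))

  fourOverlappingPairsShareAPoint₇ : FourOverlappingPairsShareAPoint 7
  fourOverlappingPairsShareAPoint₇ = from-yes (
    all? λ (i₁ : Fin 7) → all? λ j₁ → (i₁ <ᶠ? j₁) →-dec
    all? λ i₂ → all? λ j₂ → (i₂ <ᶠ? j₂) →-dec overlap? i₁ j₁ i₂ j₂ →-dec
    all? λ i₃ → all? λ j₃ → (i₃ <ᶠ? j₃) →-dec overlap? i₁ j₁ i₃ j₃ →-dec overlap? i₂ j₂ i₃ j₃ →-dec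
    all? λ i₄ → all? λ j₄ → (i₄ <ᶠ? j₄) →-dec
      overlap? i₁ j₁ i₄ j₄ →-dec overlap? i₂ j₂ i₄ j₄ →-dec overlap? i₃ j₃ i₄ j₄ →-dec
    any? λ c → ((c ≟ᶠ i₁) ⊎-dec (c ≟ᶠ j₁)) ×-dec ((c ≟ᶠ i₂) ⊎-dec (c ≟ᶠ j₂)) ×-dec
               ((c ≟ᶠ i₃) ⊎-dec (c ≟ᶠ j₃)) ×-dec ((c ≟ᶠ i₄) ⊎-dec (c ≟ᶠ j₄)))

commonPoint : (lo hi : Fin 4 → Fin 7) → ((k : Fin 4) → lo k <ᶠ hi k) →
  ((k l : Fin 4) → k ≢ l → Overlap (lo k) (hi k) (lo l) (hi l)) →
  Σ (Fin 7) λ c → (k : Fin 4) → c ∈₂ lo k , hi k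
commonPoint lo hi lo<hi overlapping
  with fourOverlappingPairsShareAPoint₇
         (lo F0) (hi F0) (lo<hi F0)
         (lo F1) (hi F1) (lo<hi F1) (overlapping F0 F1 (λ ()))
         (lo F2) (hi F2) (lo<hi F2) (overlapping F0 F2 (λ ())) (overlapping F1 F2 (λ ()))
         (lo F3) (hi F3) (lo<hi F3) (overlapping F0 F3 (λ ())) (overlapping F1 F3 (λ ())) (overlapping F2 F3 (λ ()))
... | c , c∈₀ , c∈₁ , c∈₂ , c∈₃ = c , λ { F0 → c∈₀ ; F1 → c∈₁ ; F2 → c∈₂ ; F3 → c∈₃ }

record Star {m n : ℕ} (f : Vertex m → Vertex n) (x : Vertex n) : Set where
  field
    centre : Vertex m
    leaf : Fin 5 → Fin (suc m)
    leaf-injective : Injective _≡_ _≡_ leaf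
    leaf-in-fibre : (i : Fin 5) → f (centre ⊕ gen (leaf i)) ≡ x

  leaf≢ : {i j : Fin 5} → i ≢ j → leaf i ≢ leaf j
  leaf≢ i≢j eq = i≢j (leaf-injective eq)

module Homomorphism₆₄ (f : Vertex 6 → Vertex 4) (hom : IsHom f) where

  open Fibres spannedByTwoOrThree₆ noThreeGeneratorRelation₄ fourSumsAreNotPairSums₆ f hom

  -- Five vertices of a fibre form a star: their differences to the first one are pairs of
  -- generators that pairwise overlap, hence share a common generator c.
  fibreStar : {x : Vertex 4} → FibreFamily 5 f x → Star f x
  fibreStar (u , u-injective , u-in-fibre) = record
    { centre = centre ; leaf = leaf ; leaf-injective = leaf-injective
    ; leaf-in-fibre = λ i → trans (cong f (reaches i)) (u-in-fibre i) }
    where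
    open PairStep using (lo; hi; lo<hi)
    sameImage : (i j : Fin 5) → f (u i) ≡ f (u j)
    sameImage i j = trans (u-in-fibre i) (sym (u-in-fibre j))
    step : (k : Fin 4) → PairStep (u F0) (u (suc k))
    step k = pairStep (sameImage F0 (suc k)) (λ e → 0≢1+n (u-injective e))
    overlapping : (k l : Fin 4) → k ≢ l → Overlap (lo (step k)) (hi (step k)) (lo (step l)) (hi (step l))
    overlapping k l k≢l = stepsOverlap (sameImage (suc k) (suc l))
                                       (λ e → k≢l (suc-injective (u-injective e))) (step k) (step l)
    common : Σ (Fin 7) λ c → (k : Fin 4) → c ∈₂ lo (step k) , hi (step k)
    common = commonPoint (λ k → lo (step k)) (λ k → hi (step k)) (λ k → lo<hi (step k)) overlapping
    c : Fin 7
    c = proj₁ common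
    shared : (k : Fin 4) → c ∈₂ lo (step k) , hi (step k)
    shared = proj₂ common
    partner : {i j : Fin 7} → c ∈₂ i , j → Fin 7
    partner {j = j} (inj₁ _) = j
    partner {i = i} (inj₂ _) = i
    partner-step : (w : Vertex 6) {i j : Fin 7} (c∈ : c ∈₂ i , j) →
      (w ⊕ gen c) ⊕ gen (partner c∈) ≡ w ⊕ (gen i ⊕ gen j)
    partner-step w (inj₁ refl) = ⊕-assoc w _ _
    partner-step w {i} {j} (inj₂ refl) = trans (⊕-assoc w (gen j) (gen i)) (cong (w ⊕_) (⊕-comm (gen j) (gen i)))
    centre : Vertex 6
    centre = u F0 ⊕ gen c
    leaf : Fin 5 → Fin 7
    leaf zero = c
    leaf (suc k) = partner (shared k)
    reaches : (i : Fin 5) → centre ⊕ gen (leaf i) ≡ u i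
    reaches zero = ⊕-cancelʳ (u F0) (gen c)
    reaches (suc k) = trans (partner-step (u F0) (shared k)) (sym (PairStep.reach (step k)))
    leaf-injective : Injective _≡_ _≡_ leaf
    leaf-injective {i} {j} eq = u-injective
      (trans (sym (reaches i)) (trans (cong (λ t → centre ⊕ gen t) eq) (reaches j)))

  starFibreSize : {x : Vertex 4} → Star f x → 5 ≤ fibreSize f x
  starFibreSize S = family⇒fibreSize f _
    ( (λ i → centre ⊕ gen (leaf i))
    , (λ eq → leaf-injective (gen-injective₆ _ _ (⊕-injectiveʳ centre eq)))
    , leaf-in-fibre )
    where open Star S

  -- A common neighbour of a fibre containing a star is the centre of the star: it shares
  -- the three common neighbours centre ⊕ gen (leaf i), i < 3, with the centre.
  commonNeighbour-is-centre : {x : Vertex 4} (S : Star f x) {b : Vertex 6} →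
    IsCommonNbrOfFibre f x b → b ≡ Star.centre S
  commonNeighbour-is-centre S {b} b-common with b ≟V centre
    where open Star S
  ... | yes b≡centre = b≡centre
  ... | no b≢centre = ⊥-elim (distinctLeaves F1 F2 (λ ()) (atMostTwoCommonNeighbours pairSumsDetermined₆
        (λ e → b≢centre (sym e))
        (adj-step centre (leaf F0)) (nbr F0) (adj-step centre (leaf F1)) (nbr F1)
        (adj-step centre (leaf F2)) (nbr F2)
        (distinctLeaves F0 F1 (λ ())) (distinctLeaves F0 F2 (λ ()))))
    where
    open Star S
    nbr : (i : Fin 5) → Adj (centre ⊕ gen (leaf i)) b
    nbr i = adj-sym (b-common _ (leaf-in-fibre i))
    distinctLeaves : (i j : Fin 5) → i ≢ j → centre ⊕ gen (leaf i) ≢ centre ⊕ gen (leaf j)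
    distinctLeaves i j i≢j eq = leaf≢ i≢j (gen-injective₆ _ _ (⊕-injectiveʳ centre eq))

  module _ {x : Vertex 4} (S : Star f x) where
    open Star S renaming (centre to a)

    colour : Fin 7 → Fin 7 → Vertex 4
    colour i j = f (a ⊕ (gen i ⊕ gen j))

    colour-sym : (i j : Fin 7) → colour i j ≡ colour j i
    colour-sym i j = cong (λ z → f (a ⊕ z)) (⊕-comm (gen i) (gen j))

    colour-adj : (m : Fin 5) (j : Fin 7) → Adj x (colour (leaf m) j)
    colour-adj m j = subst (λ z → Adj z (colour (leaf m) j)) (leaf-in-fibre m)
                           (hom _ _ (adj-extend a (gen (leaf m)) j))

    disjointPairsDiffer : {i j k l : Fin 7} → Distinct₄ i j k l → colour i j ≢ colour k l
    disjointPairsDiffer ijkl = separated ijkl (⊕-translate a _ _)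

    -- The three pairs in {leaf m, leaf n, l} are coloured by common neighbours of x and of
    -- the image y of a ⊕ gen (leaf m) ⊕ gen (leaf n) ⊕ gen l; a fourth leaf shows y ≢ x, so
    -- by atMostTwoCommonNeighbours two of the colours coincide.
    noRainbowTriangle : (m n q : Fin 5) (l : Fin 7) → Distinct₄ (leaf m) (leaf n) l (leaf q) →
      let i = leaf m ; j = leaf n in
      colour i j ≡ colour i l ⊎ colour i j ≡ colour j l ⊎ colour i l ≡ colour j l
    noRainbowTriangle m n q l ijlq with colour i j ≟V colour i l | colour i j ≟V colour j l
      where i = leaf m ; j = leaf n
    ... | yes e | _ = inj₁ e
    ... | no _ | yes e = inj₂ (inj₁ e)
    ... | no ij≢il | no ij≢jl = inj₂ (inj₂ (atMostTwoCommonNeighbours pairSumsDetermined₄ x≢y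
          (colour-adj m j) (hom _ _ (adj-extend a (gen i ⊕ gen j) l))
          (colour-adj m l) (subst (λ z → Adj (colour i l) (f (a ⊕ z))) (xy∙z≈xz∙y (gen i) (gen l) (gen j))
                                  (hom _ _ (adj-extend a (gen i ⊕ gen l) j)))
          (colour-adj n l) (subst (λ z → Adj (colour j l) (f (a ⊕ z))) (xy∙z≈zx∙y (gen j) (gen l) (gen i))
                                  (hom _ _ (adj-extend a (gen j ⊕ gen l) i)))
          ij≢il ij≢jl))
      where
      i = leaf m
      j = leaf n
      apex : Vertex 6
      apex = a ⊕ ((gen i ⊕ gen j) ⊕ gen l)
      x≢y : x ≢ f apex
      x≢y x≡y = separated ijlq (begin
        (a ⊕ gen (leaf q)) ⊕ apex                  ≡⟨ ⊕-translate a (gen (leaf q)) _ ⟩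
        gen (leaf q) ⊕ ((gen i ⊕ gen j) ⊕ gen l)   ≡⟨ ⊕-comm (gen (leaf q)) _ ⟩
        ((gen i ⊕ gen j) ⊕ gen l) ⊕ gen (leaf q)   ≡⟨ ⊕-assoc (gen i ⊕ gen j) (gen l) (gen (leaf q)) ⟩
        (gen i ⊕ gen j) ⊕ (gen l ⊕ gen (leaf q))   ∎) (trans (leaf-in-fibre q) x≡y)
        where open ≡-Reasoning

    leafColouring : GoodColouring (Vertex 4)
    leafColouring = record
      { colour = λ m n → colour (leaf m) (leaf n)
      ; colour-sym = λ m n → colour-sym (leaf m) (leaf n)
      ; disjointEdgesDiffer = λ m n p q ((mn , mp , np) , mq , nq , pq) →
          disjointPairsDiffer ((leaf≢ mn , leaf≢ mp , leaf≢ np) , leaf≢ mq , leaf≢ nq , leaf≢ pq)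
      ; noRainbowTriangle = λ m n p (mn , mp , np) → fourth m n p mn mp np (fourthElement m n p)
      }
      where
      fourth : (m n p : Fin 5) → m ≢ n → m ≢ p → n ≢ p → (Σ (Fin 5) λ q → q ≢ m × q ≢ n × q ≢ p) →
        let i = leaf m ; j = leaf n ; l = leaf p in
        colour i j ≡ colour i l ⊎ colour i j ≡ colour j l ⊎ colour i l ≡ colour j l
      fourth m n p mn mp np (q , qm , qn , qp) = noRainbowTriangle m n q (leaf p)
        ((leaf≢ mn , leaf≢ mp , leaf≢ np) , leaf≢ (λ e → qm (sym e)) , leaf≢ (λ e → qn (sym e))
                                          , leaf≢ (λ e → qp (sym e)))

    outside : Σ (Fin 7) λ t → (i : Fin 5) → leaf i ≢ t
    outside = missedValue (m<m+n 5 z<s) leaf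

    NeighbouringStar : Set
    NeighbouringStar = Σ (Vertex 4) λ y → Adj x y × Σ (Star f y) λ T → Adj a (Star.centre T)

    -- Given a leaf k all of whose pairs with other leaves have colour c, and a generator t
    -- that is not a leaf, the star moves to one of two neighbouring fibres.
    module Pivot (k : Fin 5) (c : Vertex 4) (row : (l : Fin 5) → l ≢ k → colour (leaf k) (leaf l) ≡ c)
                 (t : Fin 7) (t-outside : (i : Fin 5) → leaf i ≢ t) where

      -- If {leaf k, t} has colour c too, then t and the other four leaves, seen from
      -- a ⊕ gen (leaf k), form a star in f⁻¹(c).
      atLeaf : colour (leaf k) t ≡ c → NeighbouringStar
      atLeaf kt≡c = c , subst (Adj x) kt≡c (colour-adj k t) , T , adj-step a (leaf k)
        where
        leaf′ : Fin 5 → Fin 7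
        leaf′ zero = t
        leaf′ (suc j) = leaf (punchIn k j)
        leaf′-injective : Injective _≡_ _≡_ leaf′
        leaf′-injective {zero} {zero} _ = refl
        leaf′-injective {zero} {suc j} e = ⊥-elim (t-outside (punchIn k j) (sym e))
        leaf′-injective {suc i} {zero} e = ⊥-elim (t-outside (punchIn k i) e)
        leaf′-injective {suc i} {suc j} e = cong suc (punchIn-injective k i j (leaf-injective e))
        leaf′-in-fibre : (i : Fin 5) → f ((a ⊕ gen (leaf k)) ⊕ gen (leaf′ i)) ≡ c
        leaf′-in-fibre zero = trans (cong f (⊕-assoc a _ _)) kt≡c
        leaf′-in-fibre (suc j) = trans (cong f (⊕-assoc a _ _)) (row (punchIn k j) (punchInᵢ≢i k j))
        T : Star f c
        T = record { centre = a ⊕ gen (leaf k) ; leaf = leaf′ ; leaf-injective = leaf′-injective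
                   ; leaf-in-fibre = leaf′-in-fibre }

      -- Otherwise every pair {leaf m, t} has the colour of {leaf k, t}, and the five leaves,
      -- seen from a ⊕ gen t, form a star in that fibre.
      atOutside : colour (leaf k) t ≢ c → NeighbouringStar
      atOutside kt≢c = colour (leaf k) t , colour-adj k t , T , adj-step a t
        where
        sameColour : (m : Fin 5) → colour (leaf m) t ≡ colour (leaf k) t
        sameColour m with m ≟ᶠ k
        ... | yes refl = refl
        ... | no m≢k with fourthElement k m k
        ...   | r , r≢k , r≢m , _ with noRainbowTriangle k m r t
                  ( (leaf≢ (λ e → m≢k (sym e)) , t-outside k , t-outside m)
                  , leaf≢ (λ e → r≢k (sym e)) , leaf≢ (λ e → r≢m (sym e)) , λ e → t-outside r (sym e))
        ...     | inj₁ km≡kt = ⊥-elim (kt≢c (trans (sym km≡kt) (row m m≢k)))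
        ...     | inj₂ (inj₁ km≡mt) = ⊥-elim (disjointPairsDiffer
                    ( (t-outside m , leaf≢ m≢k , λ e → t-outside k (sym e))
                    , leaf≢ (λ e → r≢m (sym e)) , (λ e → t-outside r (sym e)) , leaf≢ (λ e → r≢k (sym e)))
                    (trans (sym km≡mt) (trans (row m m≢k) (sym (row r r≢k)))))
        ...     | inj₂ (inj₂ kt≡mt) = sym kt≡mt
        T : Star f (colour (leaf k) t)
        T = record
          { centre = a ⊕ gen t ; leaf = leaf ; leaf-injective = leaf-injective
          ; leaf-in-fibre = λ m → trans (cong f (trans (⊕-assoc a _ _) (cong (a ⊕_) (⊕-comm (gen t) _))))
                                         (sameColour m) }

    nextStar : NeighbouringStar
    nextStar with monochromaticVertex _≟V_ leafColouring | outside
    ... | k , c , row | t , t-outside with colour (leaf k) t ≟V c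
    ...   | yes kt≡c = Pivot.atLeaf k c row t t-outside kt≡c
    ...   | no kt≢c = Pivot.atOutside k c row t t-outside kt≢c

open Homomorphism₆₄

mainTheorem7 : (f : Vertex 6 → Vertex 4) → IsHom f → (x : Vertex 4) → 5 ≤ fibreSize f x →
    Σ (Vertex 4) λ y → Adj x y × 5 ≤ fibreSize f y ×
    ((a b : Vertex 6) → IsCommonNbrOfFibre f x a → IsCommonNbrOfFibre f y b → Adj a b)
mainTheorem7 f hom x large =
  let S = fibreStar f hom (fibreSize⇒family f x large)
      (y , x~y , T , centres-adjacent) = nextStar f hom S
  in y , x~y , starFibreSize f hom T , λ a b a-common b-common →
       subst₂ Adj (sym (commonNeighbour-is-centre f hom S a-common))
                  (sym (commonNeighbour-is-centre f hom T b-common)) centres-adjacent
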